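{- Let $H$ be a non-bi-arc graph. Then $d^*(H)\geq 2$.
   Context: Graphs may have loops; $N(v)$ is the neighborhood of $v$; vertices $u,v$ are incomparable if neither $N(u)\subseteq N(v)$ nor $N(v)\subseteq N(u)$. Bi-arc graph: fix a circle with two distinct points $p,q$; a bi-arc is a pair $(N,S)$ of arcs with $p\in N\not\ni q$, $q\in S\not\ni p$; $H$ is bi-arc if there are bi-arcs $(N_x,S_x)_{x\in V(H)}$ such that for all (not necessarily distinct) $x,y$: $xy\in E(H)$ implies $N_x\cap S_y=N_y\cap S_x=\emptyset$, and $xy\notin E(H)$ implies $N_x\cap S_y\ne\emptyset\ne N_y\cap S_x$. A lower bound structure of order $d$ in $H$: a set $L\subseteq V(H)$, distinct $x_1,\dots,x_d$, not necessarily distinct $x_1',\dots,x_d'$ with $x_i,x_i'$ incomparable for each $i$, $\bigcap_i N(x_i)\cap L=\emptyset$, and $\bigcap_i N(y_i)\cap L\ne\emptyset$ for every choice $y_i\in\{x_i,x_i'\}$ with at least one $y_i=x_i'$. $d^*(H)$ is the largest order of a lower bound structure in $H$. -}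

module Defs where

open import Data.Nat using (ℕ; _+_; _∸_; _≤_; _<_)
open import Data.Fin using (Fin; toℕ)
open import Data.Bool using (Bool; true; false; if_then_else_)
open import Data.Product using (Σ; ∃; _×_; _,_)
open import Data.Sum using (_⊎_)
open import Relation.Binary.PropositionalEquality using (_≡_; _≢_)
open import Relation.Nullary using (¬_)

-- A finite graph, possibly with loops: vertices Fin n, symmetric adjacency.
record Graph : Set where
  field
    n   : ℕ
    adj : Fin n → Fin n → Bool
    sym : ∀ u v → adj u v ≡ adj v u
open Graph public

Vertex : Graph → Set
Vertex H = Fin (n H)

Edge : (H : Graph) → Vertex H → Vertex H → Set
Edge H u v = adj H u v ≡ true

NbhdSub : (H : Graph) → Vertex H → Vertex H → Set
NbhdSub H u v = ∀ w → Edge H u w → Edge H v w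

Incomparable : (H : Graph) → Vertex H → Vertex H → Set
Incomparable H u v = ¬ NbhdSub H u v × ¬ NbhdSub H v u

-- Circle (discretised): the points 0 … M-1 in cyclic order.
-- An arc with start s and length l consists of the points
-- s, s+1, …, s+l-1 (mod M).

record Arc (M : ℕ) : Set where
  constructor arc
  field
    start : Fin M
    len   : ℕ
open Arc public

_∈A_ : ∀ {M} → Fin M → Arc M → Set
_∈A_ {M} x a =
  (toℕ (start a) ≤ toℕ x × toℕ x ∸ toℕ (start a) < len a)
  ⊎ (toℕ x < toℕ (start a) × toℕ x + M ∸ toℕ (start a) < len a)

Disjoint : ∀ {M} → Arc M → Arc M → Set
Disjoint {M} a b = ∀ (z : Fin M) → ¬ (z ∈A a × z ∈A b)

Meet : ∀ {M} → Arc M → Arc M → Set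
Meet {M} a b = Σ (Fin M) λ z → z ∈A a × z ∈A b

record BiArcRep (H : Graph) : Set where
  field
    M    : ℕ
    p q  : Fin M
    p≢q  : p ≢ q
    N S  : Vertex H → Arc M
    p∈N  : ∀ x → p ∈A N x
    q∉N  : ∀ x → ¬ (q ∈A N x)
    q∈S  : ∀ x → q ∈A S x
    p∉S  : ∀ x → ¬ (p ∈A S x)
    edge    : ∀ x y → Edge H x y →
                Disjoint (N x) (S y) × Disjoint (N y) (S x)
    nonedge : ∀ x y → ¬ Edge H x y →
                Meet (N x) (S y) × Meet (N y) (S x)

IsBiArc : Graph → Set
IsBiArc H = BiArcRep H

record LowerBoundStructure (H : Graph) (d : ℕ) : Set where
  field
    L      : Vertex H → Bool
    x x′   : Fin d → Vertex H
    x-inj  : ∀ i j → x i ≡ x j → i ≡ j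
    incomp : ∀ i → Incomparable H (x i) (x′ i)
    empty  : ¬ (Σ (Vertex H) λ v → L v ≡ true × (∀ i → Edge H (x i) v))
    -- choice c i = true means y_i = x′_i; at least one y_i = x′_i
    nonempty : ∀ (c : Fin d → Bool) → (Σ (Fin d) λ i → c i ≡ true) →
               Σ (Vertex H) λ v → L v ≡ true ×
                 (∀ i → Edge H (if c i then x′ i else x i) v)

-- Order the rows and columns of the adjacency matrix of H doubly lexically (rows and
-- columns both lexicographically non-increasing); such an ordering exists since swapping an
-- inverted pair of rows or columns increases the matrix read as a binary number. Call a 0 at
-- (i, j) with a 1 further right in row i and a 1 further down in column j a corner. Comparing
-- rows and columns at their first differences turns a corner into one in an earlier row or into
-- the 3 × 3 pattern of Obstruction, whose rows r₁, r₂, r₃ and columns c₁, c₂ give a lower bound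
-- structure of order 2: x = (r₂, r₃), x′ = (r₁, r₂), L = {c₁, c₂}. Without the pattern there
-- is no corner, so x ~ y exactly when the column index of y is less than the extent (last 1
-- plus one) of the row of x and the row index of x is less than the extent of the column of
-- y. These four numbers place an arc N x and an arc S y through q on a circle, giving a
-- bi-arc representation.
{-# OPTIONS --safe #-}
module Submission where

open import Defs hiding (sym)
open import Data.Nat using (ℕ; _≤_)
open import Data.Product using (Σ; _×_)
open import Relation.Nullary using (¬_)

open import Data.Nat using (zero; suc; _+_; _*_; _∸_; _^_; _<_; z≤n; s≤s; _≤?_)
open import Data.Nat.Properties
  using ( module ≤-Reasoning; ≤-refl; ≤-trans; <-trans; <-≤-trans; <⇒≤; <⇒≱; ≰⇒>; ≤-pred
        ; m≤n⇒m≤1+n; m≤m+n; m≤n+m; m∸n≤m; m∸n+n≡m; 1+n≢0; +-comm; +-∸-assoc; +-cancelʳ-≤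
        ; +-monoˡ-≤; +-monoʳ-≤; +-monoʳ-<; *-monoˡ-≤; ∸-monoˡ-≤; ∸-monoˡ-<; ∸-monoʳ-≤; ∸-monoʳ-<)
open import Data.Nat.Induction using (<-wellFounded)
open import Data.Fin as Fin using (Fin; zero; suc; toℕ; fromℕ; fromℕ<; inject₁)
import Data.Fin.Properties as Finₚ
open import Data.Fin.Properties
  using (any?; all?; ∀-cons; toℕ<n; toℕ-fromℕ; toℕ-fromℕ<; toℕ-inject₁)
import Data.Fin.Induction as Finᵢ
open import Data.Fin.Permutation using (Permutation′; _⟨$⟩ʳ_; _⟨$⟩ˡ_; inverseʳ; id; transpose; _∘ₚ_)
import Data.Fin.Permutation.Components as PC
open import Data.Fin.Relation.Unary.Top using (view; ‵fromℕ; ‵inject₁)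
open import Data.Vec.Functional using ([]; _∷_)
open import Data.Bool using (Bool; true; false; _∨_; if_then_else_)
open import Data.Bool.Properties using (_≟_; ∨-zeroʳ; ¬-not)
open import Data.Product using (∃; ∃₂; _,_)
open import Data.Sum using (_⊎_; inj₁; inj₂)
import Data.Sum as Sum
open import Data.Empty using (⊥; ⊥-elim)
open import Function using (_∘_)
open import Induction.WellFounded using (Acc; acc)
open import Relation.Nullary using (Dec; yes; no; does)
open import Relation.Nullary.Decidable using (_×-dec_; _→-dec_; dec-true)
open import Relation.Binary.PropositionalEquality
  using (_≡_; _≢_; _≗_; refl; sym; trans; cong; cong₂; subst; subst₂)

private
  variable
    m k : ℕ

clash : ∀ {b} → b ≡ true → b ≡ false → ⊥
clash refl ()

-- Potentials and lexicographic order

ascend : ∀ {s p} {S : Set s} {P : S → Set p} (φ : S → ℕ) {bound : ℕ} →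
         (∀ x → φ x ≤ bound) → (∀ x → P x ⊎ ∃ λ y → φ x < φ y) → S → ∃ P
ascend {P = P} φ {bound} φ≤ step x₀ = go x₀ (<-wellFounded (bound ∸ φ x₀))
  where
  go : ∀ x → Acc _<_ (bound ∸ φ x) → ∃ P
  go x (acc smaller) with step x
  ... | inj₁ Px = x , Px
  ... | inj₂ (y , φx<φy) = go y (smaller (∸-monoʳ-< φx<φy (φ≤ y)))

horner : ℕ → (Fin k → ℕ) → ℕ
horner {zero}  b f = 0
horner {suc k} b f = f zero * b ^ k + horner b (f ∘ suc)

horner< : ∀ b (f : Fin k → ℕ) → (∀ i → f i < b) → horner b f < b ^ k
horner<head+1 : ∀ b (f : Fin (suc k) → ℕ) → (∀ i → f i < b) → horner b f < suc (f zero) * b ^ k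

horner< {zero}  b f f<b = s≤s z≤n
horner< {suc k} b f f<b = ≤-trans (horner<head+1 b f f<b) (*-monoˡ-≤ (b ^ k) (f<b zero))

horner<head+1 {k} b f f<b = begin-strict
  f zero * b ^ k + horner b (f ∘ suc)
    <⟨ +-monoʳ-< (f zero * b ^ k) (horner< b (f ∘ suc) (f<b ∘ suc)) ⟩
  f zero * b ^ k + b ^ k
    ≡⟨ +-comm (f zero * b ^ k) (b ^ k) ⟩
  suc (f zero) * b ^ k
    ∎
  where open ≤-Reasoning

horner-cong : ∀ b {f g : Fin k → ℕ} → f ≗ g → horner b f ≡ horner b g
horner-cong {zero}  b f≗g = refl
horner-cong {suc k} b f≗g = cong₂ _+_ (cong (_* b ^ k) (f≗g zero)) (horner-cong b (f≗g ∘ suc))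

horner-lex : ∀ b {f g : Fin k → ℕ} → (∀ i → f i < b) → (p : Fin k) →
             (∀ q → q Fin.< p → f q ≡ g q) → f p < g p → horner b f < horner b g
horner-lex {suc k} b {f} {g} f<b zero agree fp<gp = begin-strict
  horner b f                          <⟨ horner<head+1 b f f<b ⟩
  suc (f zero) * b ^ k                ≤⟨ *-monoˡ-≤ (b ^ k) fp<gp ⟩
  g zero * b ^ k                      ≤⟨ m≤m+n (g zero * b ^ k) (horner b (g ∘ suc)) ⟩
  horner b g                          ∎
  where open ≤-Reasoning
horner-lex {suc k} b {f} {g} f<b (suc p) agree fp<gp
  rewrite agree zero (s≤s z≤n) =
  +-monoʳ-< (g zero * b ^ k)
    (horner-lex b (f<b ∘ suc) p (λ q q<p → agree (suc q) (s≤s q<p)) fp<gp)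

LexGtAt : (u v : Fin k → Bool) → Fin k → Set
LexGtAt u v p = u p ≡ true × v p ≡ false × (∀ q → q Fin.< p → u q ≡ v q)

LexGt : (u v : Fin k → Bool) → Set
LexGt u v = ∃ (LexGtAt u v)

lexGt? : (u v : Fin k → Bool) → Dec (LexGt u v)
lexGt? u v = any? λ p → u p ≟ true ×-dec v p ≟ false ×-dec
                        all? λ q → q Finₚ.<? p →-dec u q ≟ v q

≢⇒true-false : ∀ {a b : Bool} → a ≢ b → (a ≡ true × b ≡ false) ⊎ (b ≡ true × a ≡ false)
≢⇒true-false {true}  {true}  a≢b = ⊥-elim (a≢b refl)
≢⇒true-false {true}  {false} _   = inj₁ (refl , refl)
≢⇒true-false {false} {true}  _   = inj₂ (refl , refl)
≢⇒true-false {false} {false} a≢b = ⊥-elim (a≢b refl)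

lexGtAt-zero : {u v : Fin (suc k) → Bool} → u zero ≡ true × v zero ≡ false → LexGtAt u v zero
lexGtAt-zero (u₀ , v₀) = u₀ , v₀ , λ _ ()

lexGtAt-suc : {u v : Fin (suc k) → Bool} {p : Fin k} → u zero ≡ v zero →
              LexGtAt (u ∘ suc) (v ∘ suc) p → LexGtAt u v (suc p)
lexGtAt-suc u₀≡v₀ (up , vp , agree) = up , vp , λ where
  zero    _         → u₀≡v₀
  (suc q) (s≤s q<p) → agree q q<p

firstDifference : (u v : Fin k → Bool) {j : Fin k} → u j ≢ v j →
                  ∃ λ p → p Fin.≤ j × (LexGtAt u v p ⊎ LexGtAt v u p)
firstDifference {suc k} u v {j} uj≢vj with u zero ≟ v zero
... | no u₀≢v₀ = zero , z≤n , Sum.map lexGtAt-zero lexGtAt-zero (≢⇒true-false u₀≢v₀)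
... | yes u₀≡v₀ with j
...   | zero   = ⊥-elim (uj≢vj u₀≡v₀)
...   | suc j′ with firstDifference (u ∘ suc) (v ∘ suc) uj≢vj
...     | p , p≤j′ , differ =
  suc p , s≤s p≤j′ , Sum.map (lexGtAt-suc u₀≡v₀) (lexGtAt-suc (sym u₀≡v₀)) differ

bit : Bool → ℕ
bit b = if b then 1 else 0

bit<2 : ∀ b → bit b < 2
bit<2 true  = s≤s (s≤s z≤n)
bit<2 false = s≤s z≤n

binary : (Fin k → Bool) → ℕ
binary u = horner 2 (bit ∘ u)

binary< : (u : Fin k → Bool) → binary u < 2 ^ k
binary< u = horner< 2 (bit ∘ u) (bit<2 ∘ u)

binary-lex : {u v : Fin k → Bool} → LexGt u v → binary v < binary u
binary-lex {v = v} (p , up , vp , agree) =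
  horner-lex 2 (bit<2 ∘ v) p (λ q q<p → cong bit (sym (agree q q<p)))
    (subst₂ (λ b b′ → bit b < bit b′) (sym vp) (sym up) (s≤s z≤n))

-- Doubly lexical orderings of 0/1 matrices

Matrix : ℕ → ℕ → Set
Matrix m k = Fin m → Fin k → Bool

_ᵀ : Matrix m k → Matrix k m
(A ᵀ) j i = A i j

reorder : Matrix m k → Permutation′ m → Permutation′ k → Matrix m k
reorder A π τ i j = A (π ⟨$⟩ʳ i) (τ ⟨$⟩ʳ j)

rank : Matrix m k → ℕ
rank {k = k} A = horner (2 ^ k) (binary ∘ A)

rank≤ : (A : Matrix m k) → rank A ≤ (2 ^ k) ^ m
rank≤ {k = k} A = <⇒≤ (horner< (2 ^ k) (binary ∘ A) (binary< ∘ A))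

rank-lex : {A B : Matrix m k} (i : Fin m) → (∀ q → q Fin.< i → A q ≗ B q) →
           LexGt (B i) (A i) → rank A < rank B
rank-lex {k = k} {A} i agree B>A =
  horner-lex (2 ^ k) (binary< ∘ A) i (λ q q<i → horner-cong 2 (cong bit ∘ agree q q<i))
    (binary-lex B>A)

transpose-matchˡ : (i j : Fin k) → PC.transpose i j i ≡ j
transpose-matchˡ i j with i Finₚ.≟ i
... | yes _   = refl
... | no i≢i = ⊥-elim (i≢i refl)

transpose-other : {i j q : Fin k} → q ≢ i → q ≢ j → PC.transpose i j q ≡ q
transpose-other {i = i} {j} {q} q≢i q≢j with q Finₚ.≟ i
... | yes q≡i = ⊥-elim (q≢i q≡i)
... | no _ with q Finₚ.≟ j
...   | yes q≡j = ⊥-elim (q≢j q≡j)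
...   | no _    = refl

transpose-≗ : ∀ {a} {X : Set a} (f : Fin k → X) {i j : Fin k} → f i ≡ f j →
              f ∘ PC.transpose i j ≗ f
transpose-≗ f {i} {j} fi≡fj q with q Finₚ.≟ i
... | yes refl = sym fi≡fj
... | no _ with q Finₚ.≟ j
...   | yes refl = fi≡fj
...   | no _     = refl

rowSwap-increasesRank : (A : Matrix m k) {i i′ : Fin m} → i Fin.< i′ → LexGt (A i′) (A i) →
                        rank A < rank (A ∘ PC.transpose i i′)
rowSwap-increasesRank A {i} {i′} i<i′ A>A =
  rank-lex i unmoved (subst (λ r → LexGt (A r) (A i)) (sym (transpose-matchˡ i i′)) A>A)
  where
  unmoved : ∀ q → q Fin.< i → A q ≗ A (PC.transpose i i′ q)
  unmoved q q<i _ = cong (λ r → A r _) (sym (transpose-other (Finₚ.<⇒≢ q<i)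
                                                        (Finₚ.<⇒≢ (Finₚ.<-trans q<i i<i′))))

columnSwap-increasesRank : (A : Matrix m k) {j j′ : Fin k} → j Fin.< j′ →
                           LexGt ((A ᵀ) j′) ((A ᵀ) j) → rank A < rank (λ r → A r ∘ PC.transpose j j′)
columnSwap-increasesRank A {j} {j′} j<j′ (w , Awj′ , Awj , agree) =
  rank-lex w (λ r r<w → sym ∘ transpose-≗ (A r) (sym (agree r r<w)))
    (j , trans (cong (A w) (transpose-matchˡ j j′)) Awj′ , Awj , unmoved)
  where
  unmoved : ∀ q → q Fin.< j → A w (PC.transpose j j′ q) ≡ A w q
  unmoved q q<j = cong (A w) (transpose-other (Finₚ.<⇒≢ q<j) (Finₚ.<⇒≢ (Finₚ.<-trans q<j j<j′)))

RowInversion : Matrix m k → Set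
RowInversion A = ∃₂ λ i i′ → i Fin.< i′ × LexGt (A i′) (A i)

rowInversion? : (A : Matrix m k) → Dec (RowInversion A)
rowInversion? A = any? λ i → any? λ i′ → i Finₚ.<? i′ ×-dec lexGt? (A i′) (A i)

DoublyLexical : Matrix m k → Set
DoublyLexical A = ¬ RowInversion A × ¬ RowInversion (A ᵀ)

doublyLexicalOrdering : (A : Matrix m k) → ∃₂ λ π τ → DoublyLexical (reorder A π τ)
doublyLexicalOrdering {m} {k} A =
  let (π , τ) , sorted = ascend (rank ∘ matrix) (rank≤ ∘ matrix) sortStep (id , id)
  in  π , τ , sorted
  where
  matrix : Permutation′ m × Permutation′ k → Matrix m k
  matrix (π , τ) = reorder A π τ

  sortStep : ∀ x → DoublyLexical (matrix x) ⊎ ∃ λ y → rank (matrix x) < rank (matrix y)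
  sortStep (π , τ) with rowInversion? (reorder A π τ) | rowInversion? (reorder A π τ ᵀ)
  ... | yes (i , i′ , i<i′ , inv) | _ =
    inj₂ ((transpose i i′ ∘ₚ π , τ) , rowSwap-increasesRank (reorder A π τ) i<i′ inv)
  ... | no _ | yes (j , j′ , j<j′ , inv) =
    inj₂ ((π , transpose j j′ ∘ₚ τ) , columnSwap-increasesRank (reorder A π τ) j<j′ inv)
  ... | no rowsSorted | no columnsSorted = inj₁ (rowsSorted , columnsSorted)

-- The obstruction and corner-free matrices

Obstruction : Matrix m k → Set
Obstruction A = ∃ λ r₁ → ∃ λ r₂ → ∃ λ r₃ → ∃ λ c₁ → ∃ λ c₂ → ∃ λ c₃ →
  A r₁ c₁ ≡ true  × A r₁ c₂ ≡ true  × A r₁ c₃ ≡ false ×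
  A r₂ c₁ ≡ true  × A r₂ c₂ ≡ false × A r₂ c₃ ≡ true  ×
  A r₃ c₁ ≡ false × A r₃ c₂ ≡ true

obstruction? : (A : Matrix m k) → Dec (Obstruction A)
obstruction? A =
  any? λ r₁ → any? λ r₂ → any? λ r₃ → any? λ c₁ → any? λ c₂ → any? λ c₃ →
  A r₁ c₁ ≟ true  ×-dec A r₁ c₂ ≟ true  ×-dec A r₁ c₃ ≟ false ×-dec
  A r₂ c₁ ≟ true  ×-dec A r₂ c₂ ≟ false ×-dec A r₂ c₃ ≟ true  ×-dec
  A r₃ c₁ ≟ false ×-dec A r₃ c₂ ≟ true

obstruction-reorder : (A : Matrix m k) (π : Permutation′ m) (τ : Permutation′ k) →
                      Obstruction (reorder A π τ) → Obstruction A
obstruction-reorder A π τ (r₁ , r₂ , r₃ , c₁ , c₂ , c₃ , entries) =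
  π ⟨$⟩ʳ r₁ , π ⟨$⟩ʳ r₂ , π ⟨$⟩ʳ r₃ , τ ⟨$⟩ʳ c₁ , τ ⟨$⟩ʳ c₂ , τ ⟨$⟩ʳ c₃ , entries

Corner : Matrix m k → Fin m → Fin m → Fin k → Fin k → Set
Corner A i i′ j j′ = i Fin.< i′ × j Fin.< j′ × A i j ≡ false × A i j′ ≡ true × A i′ j ≡ true

CornerFree : Matrix m k → Set
CornerFree A = ∀ {i i′ j j′} → ¬ Corner A i i′ j j′

-- Compare rows i, i′ and columns j, j′ at their first differences p and w: in a doubly
-- lexical matrix the 1s there lie in row i and column j, and the entry (w, p) either
-- completes an obstruction on rows w, i, i′ and columns p, j, j′ or is a smaller corner.
corner-descent : {A : Matrix m k} → DoublyLexical A → ∀ {i i′ j j′} → Corner A i i′ j j′ →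
                 Obstruction A ⊎ ∃₂ λ w p → w Fin.< i × Corner A w i p j
corner-descent {A = A} (rowsSorted , columnsSorted) {i} {i′} {j} {j′}
               (i<i′ , j<j′ , Aij , Aij′ , Ai′j)
  with firstDifference (A i) (A i′) (λ e → clash (trans e Ai′j) Aij)
     | firstDifference ((A ᵀ) j) ((A ᵀ) j′) (λ e → clash (trans e Aij′) Aij)
... | p , _ , inj₂ rowInv | _ = ⊥-elim (rowsSorted (i , i′ , i<i′ , p , rowInv))
... | _ | w , _ , inj₂ columnInv = ⊥-elim (columnsSorted (j , j′ , j<j′ , w , columnInv))
... | p , p≤j , inj₁ (Aip , Ai′p , _) | w , w≤i , inj₁ (Awj , Awj′ , _) with A w p in Awp
...   | true  = inj₁ (w , i , i′ , p , j , j′ , Awp , Awj , Awj′ , Aip , Aij , Aij′ , Ai′p , Ai′j)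
...   | false = inj₂ (w , p , w<i , w<i , p<j , Awp , Awj , Aip)
  where
  p<j : p Fin.< j
  p<j = Finₚ.≤∧≢⇒< p≤j λ { refl → clash Aip Aij }
  w<i : w Fin.< i
  w<i = Finₚ.≤∧≢⇒< w≤i λ { refl → clash Awj Aij }

doublyLexical⇒cornerFree : {A : Matrix m k} → DoublyLexical A → ¬ Obstruction A → CornerFree A
doublyLexical⇒cornerFree {A = A} sorted ¬obstruction = go (Finᵢ.<-wellFounded _)
  where
  go : ∀ {i i′ j j′} → Acc Fin._<_ i → ¬ Corner A i i′ j j′
  go (acc smaller) corner with corner-descent sorted corner
  ... | inj₁ obstruction = ¬obstruction obstruction
  ... | inj₂ (_ , _ , w<i , corner′) = go (smaller w<i) corner′

extent : (Fin k → Bool) → ℕ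
extent {zero}  u = 0
extent {suc k} u = if u (fromℕ k) then suc k else extent (u ∘ inject₁)

extent≤ : (u : Fin k → Bool) → extent u ≤ k
extent≤ {zero}  u = z≤n
extent≤ {suc k} u with u (fromℕ k)
... | true  = ≤-refl
... | false = m≤n⇒m≤1+n (extent≤ (u ∘ inject₁))

extent-complete : (u : Fin k → Bool) {j : Fin k} → u j ≡ true → toℕ j < extent u
extent-complete {suc k} u {j} uj with u (fromℕ k) in last | view j
... | true  | _           = toℕ<n j
... | false | ‵fromℕ      = ⊥-elim (clash uj last)
... | false | ‵inject₁ j′ =
  subst (_< extent (u ∘ inject₁)) (sym (toℕ-inject₁ j′)) (extent-complete (u ∘ inject₁) uj)

extent-sound : (u : Fin k → Bool) {t : ℕ} → t < extent u → ∃ λ j → t ≤ toℕ j × u j ≡ true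
extent-sound {suc k} u {t} t<e with u (fromℕ k) in last
... | true  = fromℕ k , subst (t ≤_) (sym (toℕ-fromℕ k)) (≤-pred t<e) , last
... | false with extent-sound (u ∘ inject₁) t<e
...   | j , t≤j , uj = inject₁ j , subst (t ≤_) (sym (toℕ-inject₁ j)) t≤j , uj

entry⇒withinExtents : (A : Matrix m k) {i : Fin m} {j : Fin k} → A i j ≡ true →
                      toℕ j < extent (A i) × toℕ i < extent ((A ᵀ) j)
entry⇒withinExtents A Aij = extent-complete (A _) Aij , extent-complete ((A ᵀ) _) Aij

cornerFree⇒beyondExtent : {A : Matrix m k} → CornerFree A → ∀ {i j} → A i j ≡ false →
                          extent (A i) ≤ toℕ j ⊎ extent ((A ᵀ) j) ≤ toℕ i
cornerFree⇒beyondExtent {A = A} cornerFree {i} {j} Aij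
  with extent (A i) ≤? toℕ j | extent ((A ᵀ) j) ≤? toℕ i
... | yes beyond | _          = inj₁ beyond
... | no _       | yes beyond = inj₂ beyond
... | no within  | no within′
  with extent-sound (A i) (≰⇒> within) | extent-sound ((A ᵀ) j) (≰⇒> within′)
...   | j′ , j≤j′ , Aij′ | i′ , i≤i′ , Ai′j = ⊥-elim (cornerFree (i<i′ , j<j′ , Aij , Aij′ , Ai′j))
  where
  j<j′ : j Fin.< j′
  j<j′ = Finₚ.≤∧≢⇒< j≤j′ λ { refl → clash Aij′ Aij }
  i<i′ : i Fin.< i′
  i<i′ = Finₚ.≤∧≢⇒< i≤i′ λ { refl → clash Ai′j Aij }

-- Threshold models and bi-arc representations

record ThresholdModel (H : Graph) : Set where
  field
    bound                       : ℕ
    row col rowExtent colExtent : Vertex H → ℕ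
    rowExtent≤ : ∀ x → rowExtent x ≤ bound
    colExtent≤ : ∀ y → colExtent y ≤ bound
    edge⇒      : ∀ {x y} → Edge H x y → col y < rowExtent x × row x < colExtent y
    nonEdge⇒   : ∀ {x y} → ¬ Edge H x y → rowExtent x ≤ col y ⊎ colExtent y ≤ row x

obstructionFree⇒thresholdModel : (H : Graph) → ¬ Obstruction (adj H) → ThresholdModel H
obstructionFree⇒thresholdModel H ¬obstruction with doublyLexicalOrdering (adj H)
... | π , τ , sorted = record
  { bound      = n H
  ; row        = λ x → toℕ (π ⟨$⟩ˡ x)
  ; col        = λ y → toℕ (τ ⟨$⟩ˡ y)
  ; rowExtent  = λ x → extent (A (π ⟨$⟩ˡ x))
  ; colExtent  = λ y → extent ((A ᵀ) (τ ⟨$⟩ˡ y))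
  ; rowExtent≤ = λ x → extent≤ (A (π ⟨$⟩ˡ x))
  ; colExtent≤ = λ y → extent≤ ((A ᵀ) (τ ⟨$⟩ˡ y))
  ; edge⇒      = λ {x} {y} e → entry⇒withinExtents A (trans (position x y) e)
  ; nonEdge⇒   = λ {x} {y} ¬e → cornerFree⇒beyondExtent cornerFree (trans (position x y) (¬-not ¬e))
  }
  where
  A : Matrix (n H) (n H)
  A = reorder (adj H) π τ

  cornerFree : CornerFree A
  cornerFree = doublyLexical⇒cornerFree sorted (¬obstruction ∘ obstruction-reorder (adj H) π τ)

  position : ∀ x y → A (π ⟨$⟩ˡ x) (τ ⟨$⟩ˡ y) ≡ adj H x y
  position x y = cong₂ (adj H) (inverseʳ π) (inverseʳ τ)

module _ {M : ℕ} where

  -- Opaque, so that the endpoints of an arc can be inferred from it by unification.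
  opaque
    interval : {a : ℕ} → a < M → ℕ → Arc M
    interval {a} a<M b = arc (fromℕ< a<M) (suc (b ∸ a))

    -- The arc from c through M - 1 and 0 to d.
    coInterval : {c : ℕ} → c < M → ℕ → Arc M
    coInterval {c} c<M d = arc (fromℕ< c<M) (suc (d + (M ∸ c)))

    ∈-interval⁺ : ∀ {a b t} {a<M : a < M} (t<M : t < M) → a ≤ t → t ≤ b →
                  fromℕ< t<M ∈A interval a<M b
    ∈-interval⁺ {a} {a<M = a<M} t<M a≤t t≤b
      rewrite toℕ-fromℕ< a<M | toℕ-fromℕ< t<M = inj₁ (a≤t , s≤s (∸-monoˡ-≤ a t≤b))

    ∈-interval⁻ : ∀ {a b} {a<M : a < M} → a ≤ b → b < M → (z : Fin M) → z ∈A interval a<M b →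
                  a ≤ toℕ z × toℕ z ≤ b
    ∈-interval⁻ {a} {b} {a<M} a≤b b<M z z∈ rewrite toℕ-fromℕ< a<M with z∈
    ... | inj₁ (a≤z , z∸a<) =
      a≤z , subst₂ _≤_ (m∸n+n≡m a≤z) (m∸n+n≡m a≤b) (+-monoˡ-≤ a (≤-pred z∸a<))
    ... | inj₂ (_ , wrapped) = ⊥-elim (<⇒≱ b∸a<z+M∸a (≤-pred wrapped))
      where
      b∸a<z+M∸a : b ∸ a < toℕ z + M ∸ a
      b∸a<z+M∸a = <-≤-trans (∸-monoˡ-< b<M a≤b) (∸-monoˡ-≤ a (m≤n+m M (toℕ z)))

    ∈-coInterval⁺ : ∀ {c d t} {c<M : c < M} (t<M : t < M) → c ≤ t ⊎ t ≤ d →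
                    fromℕ< t<M ∈A coInterval c<M d
    ∈-coInterval⁺ {c} {d} {t} {c<M} t<M c≤t⊎t≤d
      rewrite toℕ-fromℕ< c<M | toℕ-fromℕ< t<M with c ≤? t | c≤t⊎t≤d
    ... | yes c≤t | _ = inj₁ (c≤t , s≤s (≤-trans (∸-monoˡ-≤ c (<⇒≤ t<M)) (m≤n+m (M ∸ c) d)))
    ... | no c≰t | inj₁ c≤t = ⊥-elim (c≰t c≤t)
    ... | no c≰t | inj₂ t≤d =
      inj₂ (≰⇒> c≰t , s≤s (subst (_≤ d + (M ∸ c)) (sym (+-∸-assoc t (<⇒≤ c<M)))
                                 (+-monoˡ-≤ (M ∸ c) t≤d)))

    ∈-coInterval⁻ : ∀ {c d} {c<M : c < M} (z : Fin M) → z ∈A coInterval c<M d →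
                    c ≤ toℕ z ⊎ toℕ z ≤ d
    ∈-coInterval⁻ {c} {d} {c<M} z z∈ rewrite toℕ-fromℕ< c<M with z∈
    ... | inj₁ (c≤z , _)     = inj₁ c≤z
    ... | inj₂ (_ , wrapped) =
      inj₂ (+-cancelʳ-≤ (M ∸ c) (toℕ z) d
              (subst (_≤ d + (M ∸ c)) (+-∸-assoc (toℕ z) (<⇒≤ c<M)) (≤-pred wrapped)))

  interval-coInterval-disjoint : ∀ {a b c d} {a<M : a < M} {c<M : c < M} → a ≤ b → b < M →
                                 b < c → d < a → Disjoint (interval a<M b) (coInterval c<M d)
  interval-coInterval-disjoint a≤b b<M b<c d<a z (z∈N , z∈S)
    with ∈-interval⁻ a≤b b<M z z∈N | ∈-coInterval⁻ z z∈S
  ... | _ , z≤b | inj₁ c≤z = <⇒≱ b<c (≤-trans c≤z z≤b)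
  ... | a≤z , _ | inj₂ z≤d = <⇒≱ d<a (≤-trans a≤z z≤d)

  interval-coInterval-meet : ∀ {a b c d t} {a<M : a < M} {c<M : c < M} (t<M : t < M) →
                             a ≤ t → t ≤ b → c ≤ t ⊎ t ≤ d →
                             Meet (interval a<M b) (coInterval c<M d)
  interval-coInterval-meet t<M a≤t t≤b t∈S =
    fromℕ< t<M , ∈-interval⁺ t<M a≤t t≤b , ∈-coInterval⁺ t<M t∈S

-- The circle 0 … M - 1 is cut into q = 0, a lower block 1 … b + 1, the point p = b + 2 and an
-- upper block b + 3 … 2b + 3; low and high map 0 … b order-reversingly into the two blocks.
module Layout (b : ℕ) where

  M : ℕ
  M = 4 + (b + b)

  mid : ℕ
  mid = 2 + b

  low high : ℕ → ℕ
  low  t = suc (b ∸ t)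
  high t = 3 + (b + (b ∸ t))

  low<mid : ∀ t → low t < mid
  low<mid t = s≤s (s≤s (m∸n≤m b t))

  mid<high : ∀ t → mid < high t
  mid<high t = s≤s (s≤s (s≤s (m≤m+n b (b ∸ t))))

  high<M : ∀ t → high t < M
  high<M t = s≤s (s≤s (s≤s (s≤s (+-monoʳ-≤ b (m∸n≤m b t)))))

  mid<M : mid < M
  mid<M = <-trans (mid<high 0) (high<M 0)

  low<M : ∀ t → low t < M
  low<M t = <-trans (low<mid t) mid<M

  low≤high : ∀ t t′ → low t ≤ high t′
  low≤high t t′ = <⇒≤ (<-trans (low<mid t) (mid<high t′))

  low-antitone : ∀ {t t′} → t ≤ t′ → low t′ ≤ low t
  low-antitone t≤t′ = s≤s (∸-monoʳ-≤ b t≤t′)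

  low-antitone-< : ∀ {t t′} → t < t′ → t′ ≤ b → low t′ < low t
  low-antitone-< t<t′ t′≤b = s≤s (∸-monoʳ-< t<t′ t′≤b)

  high-antitone : ∀ {t t′} → t ≤ t′ → high t′ ≤ high t
  high-antitone t≤t′ = +-monoʳ-≤ (3 + b) (∸-monoʳ-≤ b t≤t′)

  high-antitone-< : ∀ {t t′} → t < t′ → t′ ≤ b → high t′ < high t
  high-antitone-< t<t′ t′≤b = +-monoʳ-< (3 + b) (∸-monoʳ-< t<t′ t′≤b)

-- As low and high reverse order, N x and S y are disjoint exactly when col y < rowExtent x
-- and row x < colExtent y.
thresholdModel⇒biArc : {H : Graph} → ThresholdModel H → IsBiArc H
thresholdModel⇒biArc {H} T = record
  { M       = M
  ; p       = p
  ; q       = zero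
  ; p≢q     = λ p≡q → 1+n≢0 (trans (sym (toℕ-fromℕ< mid<M)) (cong toℕ p≡q))
  ; N       = N
  ; S       = S
  ; p∈N     = λ x → ∈-interval⁺ mid<M (<⇒≤ (low<mid (row x))) (<⇒≤ (mid<high (rowExtent x)))
  ; q∉N     = q∉N
  ; q∈S     = λ y → ∈-coInterval⁺ (s≤s z≤n) (inj₂ z≤n)
  ; p∉S     = p∉S
  ; edge    = λ x y e → disjoint e , disjoint (trans (Graph.sym H y x) e)
  ; nonedge = λ x y ¬e → meet ¬e , meet (¬e ∘ trans (Graph.sym H x y))
  }
  where
  open ThresholdModel T
  open Layout bound

  p : Fin M
  p = fromℕ< mid<M

  N S : Vertex H → Arc M
  N x = interval (low<M (row x)) (high (rowExtent x))
  S y = coInterval (high<M (col y)) (low (colExtent y))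

  q∉N : ∀ x → ¬ zero ∈A N x
  q∉N x 0∈N with ∈-interval⁻ (low≤high (row x) (rowExtent x)) (high<M (rowExtent x)) zero 0∈N
  ... | () , _

  p∉S : ∀ y → ¬ p ∈A S y
  p∉S y p∈S with ∈-coInterval⁻ p p∈S
  ... | inj₁ high≤p = <⇒≱ (mid<high (col y)) (subst (high (col y) ≤_) (toℕ-fromℕ< mid<M) high≤p)
  ... | inj₂ p≤low  =
    <⇒≱ (low<mid (colExtent y)) (subst (_≤ low (colExtent y)) (toℕ-fromℕ< mid<M) p≤low)

  disjoint : ∀ {x y} → Edge H x y → Disjoint (N x) (S y)
  disjoint {x} {y} e =
    let col<rowExtent , row<colExtent = edge⇒ e
    in  interval-coInterval-disjoint (low≤high (row x) (rowExtent x)) (high<M (rowExtent x))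
          (high-antitone-< col<rowExtent (rowExtent≤ x))
          (low-antitone-< row<colExtent (colExtent≤ y))

  meet : ∀ {x y} → ¬ Edge H x y → Meet (N x) (S y)
  meet {x} {y} ¬e with nonEdge⇒ ¬e
  ... | inj₁ rowExtent≤col =
    interval-coInterval-meet (high<M (col y))
      (low≤high (row x) (col y)) (high-antitone rowExtent≤col) (inj₁ ≤-refl)
  ... | inj₂ colExtent≤row =
    interval-coInterval-meet (low<M (colExtent y))
      (low-antitone colExtent≤row) (low≤high (colExtent y) (rowExtent x)) (inj₂ ≤-refl)

-- The obstruction as a lower bound structure

escape : (H : Graph) {x y z : Vertex H} → Edge H x z → adj H y z ≡ false → ¬ NbhdSub H x y
escape H xz yz N[x]⊆N[y] = clash (N[x]⊆N[y] _ xz) yz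

someTrue : (c : Fin 2 → Bool) (i : Fin 2) → c i ≡ true → c zero ∨ c (suc zero) ≡ true
someTrue c zero       cᵢ rewrite cᵢ = refl
someTrue c (suc zero) cᵢ rewrite cᵢ = ∨-zeroʳ (c zero)

obstruction⇒lowerBoundStructure : (H : Graph) → Obstruction (adj H) → LowerBoundStructure H 2
obstruction⇒lowerBoundStructure H
  (r₁ , r₂ , r₃ , c₁ , c₂ , c₃ , e₁₁ , e₁₂ , e₁₃ , e₂₁ , e₂₂ , e₂₃ , e₃₁ , e₃₂) = record
  { L        = L
  ; x        = r₂ ∷ r₃ ∷ []
  ; x′       = r₁ ∷ r₂ ∷ []
  ; x-inj    = x-inj
  ; incomp   = ∀-cons (escape H e₂₃ e₁₃ , escape H e₁₂ e₂₂)
                      (∀-cons (escape H e₃₂ e₂₂ , escape H e₂₁ e₃₁) λ ())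
  ; empty    = empty
  ; nonempty = λ c (i , cᵢ) →
      let z , Lz , e₀ , e₁ = commonNeighbour (c zero) (c (suc zero)) (someTrue c i cᵢ)
      in  z , Lz , ∀-cons e₀ (∀-cons e₁ λ ())
  }
  where
  L : Vertex H → Bool
  L z = does (z Finₚ.≟ c₁) ∨ does (z Finₚ.≟ c₂)

  L-c₁ : L c₁ ≡ true
  L-c₁ rewrite dec-true (c₁ Finₚ.≟ c₁) refl = refl

  L-c₂ : L c₂ ≡ true
  L-c₂ rewrite dec-true (c₂ Finₚ.≟ c₂) refl = ∨-zeroʳ _

  r₂≢r₃ : r₂ ≢ r₃
  r₂≢r₃ refl = clash e₃₂ e₂₂

  x-inj : ∀ i j → (r₂ ∷ r₃ ∷ []) i ≡ (r₂ ∷ r₃ ∷ []) j → i ≡ j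
  x-inj zero       zero       _     = refl
  x-inj zero       (suc zero) r₂≡r₃ = ⊥-elim (r₂≢r₃ r₂≡r₃)
  x-inj (suc zero) zero       r₃≡r₂ = ⊥-elim (r₂≢r₃ (sym r₃≡r₂))
  x-inj (suc zero) (suc zero) _     = refl

  empty : ¬ (∃ λ z → L z ≡ true × (∀ i → Edge H ((r₂ ∷ r₃ ∷ []) i) z))
  empty (z , _ , adjacent) with z Finₚ.≟ c₁ | z Finₚ.≟ c₂
  ... | yes refl | _        = clash (adjacent (suc zero)) e₃₁
  ... | no _     | yes refl = clash (adjacent zero) e₂₂
  empty (z , () , _) | no _ | no _

  commonNeighbour : ∀ b₀ b₁ → b₀ ∨ b₁ ≡ true →
           ∃ λ z → L z ≡ true × Edge H (if b₀ then r₁ else r₂) z × Edge H (if b₁ then r₂ else r₃) z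
  commonNeighbour true  false _ = c₂ , L-c₂ , e₁₂ , e₃₂
  commonNeighbour false true  _ = c₁ , L-c₁ , e₂₁ , e₂₁
  commonNeighbour true  true  _ = c₁ , L-c₁ , e₁₁ , e₂₁
  commonNeighbour false false ()

mainTheorem6 : (H : Graph) → ¬ IsBiArc H →
    Σ ℕ λ d → 2 ≤ d × LowerBoundStructure H d
mainTheorem6 H ¬biArc with obstruction? (adj H)
... | yes obstruction = 2 , ≤-refl , obstruction⇒lowerBoundStructure H obstruction
... | no ¬obstruction =
  ⊥-elim (¬biArc (thresholdModel⇒biArc (obstructionFree⇒thresholdModel H ¬obstruction)))
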